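{- Let $h=(n,\dots,n)$. Then \[ \mathrm{LLT}_h(z;q+1)=\sum_{I\subset[n-1]}\Big(\prod_{j\in[n-1]\setminus I}\big((q+1)^j-1\big)\Big)e_{P(I)}. \]
   Context: $h=(n,\dots,n)$ means $h(j)=n$ for all $j\in[n]$. $\mathrm{LLT}_h(z;q)=\sum_{\kappa\colon[n]\to\mathbb P}z_{\kappa(1)}\cdots z_{\kappa(n)}q^{\mathrm{asc}(\kappa)}$, where $\mathrm{asc}(\kappa)$ is the number of pairs $i<j\le h(i)$ with $\kappa(i)<\kappa(j)$ (here: all pairs $i<j$ with $\kappa(i)<\kappa(j)$). For $I=\{i_1<\cdots<i_d\}\subset[n-1]$, $P(I)$ is the partition of $n$ with parts $i_1,i_2-i_1,\dots,n-i_d$, and $e_\lambda$ denotes the elementary symmetric function. -}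

module Defs where

open import Level using (Level)
open import Data.Nat as ℕ using (ℕ; zero; suc)
open import Data.Fin as F using (Fin; toℕ)
open import Data.Fin.Subset using (Subset; ∣_∣)
open import Data.Bool using (Bool; true; false; if_then_else_)
open import Data.List as L using (List; []; _∷_; map; concatMap; foldr)
open import Data.Vec as V using (Vec; []; _∷_; lookup)
open import Relation.Nullary.Decidable using (does)
open import Algebra.Bundles using (CommutativeRing)
open import Data.Nat.ListAction using (sum)

allVecs : (k m : ℕ) → List (Vec (Fin m) k)
allVecs zero    m = [] ∷ []
allVecs (suc k) m = concatMap (λ v → map (λ a → a ∷ v) (L.allFin m)) (allVecs k m)

allSubsets : (m : ℕ) → List (Subset m)
allSubsets zero    = [] ∷ []
allSubsets (suc m) = concatMap (λ s → (true ∷ s) ∷ (false ∷ s) ∷ []) (allSubsets m)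

-- asc(κ) for h = (n,…,n): number of pairs i < j with κ(i) < κ(j)
asc : {n m : ℕ} → Vec (Fin m) n → ℕ
asc {n} κ = sum (map (λ i → sum (map (λ j →
    if does (i F.<? j) then (if does (lookup κ i F.<? lookup κ j) then 1 else 0) else 0)
  (L.allFin n))) (L.allFin n))

-- P(I) for I ⊂ [k] (position j ∈ Fin k stands for j+1), partition of n = k+1,
-- listed as the composition (i₁, i₂ - i₁, …, n - i_d)
partsGo : {k : ℕ} → ℕ → Vec Bool k → List ℕ
partsGo c []          = suc c ∷ []
partsGo c (true ∷ b)  = suc c ∷ partsGo 0 b
partsGo c (false ∷ b) = partsGo (suc c) b

P : {k : ℕ} → Subset k → List ℕ
P I = partsGo 0 I

module _ {c ℓ : Level} (R : CommutativeRing c ℓ) where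
  open CommutativeRing R

  Σᴸ : {A : Set} → List A → (A → Carrier) → Carrier
  Σᴸ xs f = foldr (λ x acc → f x + acc) 0# xs

  Πᴸ : {A : Set} → List A → (A → Carrier) → Carrier
  Πᴸ xs f = foldr (λ x acc → f x * acc) 1# xs

  pow : Carrier → ℕ → Carrier
  pow x zero    = 1#
  pow x (suc k) = x * pow x k

  -- LLT_h(z;q) with h = (n,…,n), with the variables z_{m+1}, z_{m+2}, … set to 0
  LLT : (n m : ℕ) → (Fin m → Carrier) → Carrier → Carrier
  LLT n m z q = Σᴸ (allVecs n m) (λ κ →
    Πᴸ (L.allFin n) (λ i → z (lookup κ i)) * pow q (asc κ))

  e : (m : ℕ) → (Fin m → Carrier) → ℕ → Carrier
  e m z r = Σᴸ (allSubsets m) (λ S →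
    if does (∣ S ∣ ℕ.≟ r)
      then Πᴸ (L.allFin m) (λ i → if lookup S i then z i else 1#)
      else 0#)

  eλ : (m : ℕ) → (Fin m → Carrier) → List ℕ → Carrier
  eλ m z λs = Πᴸ λs (e m z)

  RHS : (k m : ℕ) → (Fin m → Carrier) → Carrier → Carrier
  RHS k m z q = Σᴸ (allSubsets k) (λ I →
    Πᴸ (L.allFin k) (λ j →
      if lookup I j then 1# else (pow (q + 1#) (suc (toℕ j)) - 1#))
    * eλ m z (P I))

-- Write t = q + 1 and Lₙ = LLT_(n,…,n)(z; t).  Both sides, as sequences in n, satisfy
--   X₀ = 1,   X_(n+1) = ∑_(β+ρ=n) (t^(ρ+1) − 1) ⋯ (t^(ρ+β) − 1) · e_(β+1) · X_ρ,
-- which determines them.  For the right-hand side this is the decomposition of I by the last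
-- part of P(I).  For L we induct on the number of variables: the occurrences of the smallest
-- variable z₀ interleave with the other letters, so Lₙ(z₀, z′) = ∑_(s+r=n) [n choose s]_t z₀^s L_r(z′),
-- and the two Pascal rules for the Gaussian binomials, together with
-- e_k(z₀, z′) = e_k(z′) + z₀ e_(k−1)(z′), carry the recursion from z′ to (z₀, z′).

module Submission where

open import Level using (Level)
open import Function using (id; _∘_)
open import Data.Bool using (Bool; true; false; if_then_else_)
open import Data.Nat as ℕ using (ℕ; zero; suc; s≤s)
open import Data.Nat.Induction using (<-rec)
import Data.Nat.Properties as ℕₚ
open import Data.Nat.ListAction using (sum)
open import Data.Fin as Fin using (Fin)
open import Data.Fin.Subset using (Subset; ∣_∣)
open import Data.List as List using (List; []; _∷_; map; concatMap; foldr; _++_)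
open import Data.List.Properties using (map-tabulate; map-cong; foldr-map)
open import Data.Vec using (Vec; []; _∷_; lookup)
open import Relation.Nullary.Decidable using (does)
open import Relation.Binary.PropositionalEquality as ≡ using (_≡_)
open import Algebra.Bundles using (CommutativeRing)
import Algebra.Properties.Group as GroupProperties
import Algebra.Solver.Ring.NaturalCoefficients.Default as NaturalCoefficientSolver
import Relation.Binary.Reasoning.Setoid as SetoidReasoning
open import Defs

allFin-suc : (n : ℕ) → List.allFin (suc n) ≡ Fin.zero ∷ map Fin.suc (List.allFin n)
allFin-suc n = ≡.cong (Fin.zero ∷_) (≡.sym (map-tabulate id Fin.suc))

foldr-allFin-suc : {b : Level} {B : Set b} (n : ℕ) (f : Fin (suc n) → B → B) (e : B) →
  foldr f e (List.allFin (suc n)) ≡ f Fin.zero (foldr (f ∘ Fin.suc) e (List.allFin n))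
foldr-allFin-suc n f e = ≡.trans (≡.cong (foldr f e) (allFin-suc n))
  (≡.cong (f Fin.zero) (foldr-map f Fin.suc e (List.allFin n)))

sum-map-allFin-suc : (n : ℕ) (f : Fin (suc n) → ℕ) →
  sum (map f (List.allFin (suc n))) ≡ f Fin.zero ℕ.+ sum (map (f ∘ Fin.suc) (List.allFin n))
sum-map-allFin-suc n f = begin
  sum (map f (List.allFin (suc n)))                          ≡⟨ foldr-map ℕ._+_ f 0 (List.allFin (suc n)) ⟩
  foldr (λ i s → f i ℕ.+ s) 0 (List.allFin (suc n))          ≡⟨ foldr-allFin-suc n (λ i s → f i ℕ.+ s) 0 ⟩
  f Fin.zero ℕ.+ foldr (λ i s → f (Fin.suc i) ℕ.+ s) 0 (List.allFin n)
    ≡⟨ ≡.cong (f Fin.zero ℕ.+_) (≡.sym (foldr-map ℕ._+_ (f ∘ Fin.suc) 0 (List.allFin n))) ⟩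
  f Fin.zero ℕ.+ sum (map (f ∘ Fin.suc) (List.allFin n))     ∎
  where open ≡.≡-Reasoning

ascentsFrom : {n m : ℕ} → Fin m → Vec (Fin m) n → ℕ
ascentsFrom {n} a v = sum (map (λ j → if does (a Fin.<? lookup v j) then 1 else 0) (List.allFin n))

asc-∷ : {n m : ℕ} (a : Fin m) (v : Vec (Fin m) n) → asc (a ∷ v) ≡ ascentsFrom a v ℕ.+ asc v
asc-∷ {n} a v = ≡.trans (sum-map-allFin-suc n (λ i → sum (map (ascent i) (List.allFin (suc n)))))
  (≡.cong₂ ℕ._+_ (sum-map-allFin-suc n (ascent Fin.zero))
    (≡.cong sum (map-cong (λ i → sum-map-allFin-suc n (ascent (Fin.suc i))) (List.allFin n))))
  where
  ascent : Fin (suc n) → Fin (suc n) → ℕ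
  ascent i j = if does (i Fin.<? j) then (if does (lookup (a ∷ v) i Fin.<? lookup (a ∷ v) j) then 1 else 0) else 0

module _ {c ℓ : Level} (R : CommutativeRing c ℓ) where
  open CommutativeRing R hiding (zero)
  open GroupProperties +-group using (∙-cancelʳ)
  open NaturalCoefficientSolver commutativeSemiring using (solve; _:=_; _:+_; _:*_; con)
  open SetoidReasoning setoid

  ∑ : {A : Set} → List A → (A → Carrier) → Carrier
  ∑ = Σᴸ R

  ∏ : {A : Set} → List A → (A → Carrier) → Carrier
  ∏ = Πᴸ R

  infixr 8 _^_
  _^_ : Carrier → ℕ → Carrier
  _^_ = pow R

  ∑-cong : {A : Set} (xs : List A) {f g : A → Carrier} → (∀ x → f x ≈ g x) → ∑ xs f ≈ ∑ xs g
  ∑-cong []       f≈g = refl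
  ∑-cong (x ∷ xs) f≈g = +-cong (f≈g x) (∑-cong xs f≈g)

  ∏-cong : {A : Set} (xs : List A) {f g : A → Carrier} → (∀ x → f x ≈ g x) → ∏ xs f ≈ ∏ xs g
  ∏-cong []       f≈g = refl
  ∏-cong (x ∷ xs) f≈g = *-cong (f≈g x) (∏-cong xs f≈g)

  ∑-++ : {A : Set} (xs ys : List A) (f : A → Carrier) → ∑ (xs ++ ys) f ≈ ∑ xs f + ∑ ys f
  ∑-++ []       ys f = sym (+-identityˡ _)
  ∑-++ (x ∷ xs) ys f = trans (+-congˡ (∑-++ xs ys f)) (sym (+-assoc _ _ _))

  ∑-concatMap : {A B : Set} (h : A → List B) (xs : List A) (f : B → Carrier) →
    ∑ (concatMap h xs) f ≈ ∑ xs (λ x → ∑ (h x) f)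
  ∑-concatMap h []       f = refl
  ∑-concatMap h (x ∷ xs) f = trans (∑-++ (h x) (concatMap h xs) f) (+-congˡ (∑-concatMap h xs f))

  ∑-map : {A B : Set} (h : A → B) (xs : List A) (f : B → Carrier) → ∑ (map h xs) f ≈ ∑ xs (f ∘ h)
  ∑-map h []       f = refl
  ∑-map h (x ∷ xs) f = +-congˡ (∑-map h xs f)

  ∑-+ : {A : Set} (xs : List A) (f g : A → Carrier) → ∑ xs (λ x → f x + g x) ≈ ∑ xs f + ∑ xs g
  ∑-+ []       f g = sym (+-identityˡ _)
  ∑-+ (x ∷ xs) f g = trans (+-congˡ (∑-+ xs f g))
    (solve 4 (λ a b c d → (a :+ b) :+ (c :+ d) := (a :+ c) :+ (b :+ d)) refl (f x) (g x) (∑ xs f) (∑ xs g))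

  *-distribˡ-∑ : {A : Set} (xs : List A) (k : Carrier) (f : A → Carrier) → k * ∑ xs f ≈ ∑ xs (λ x → k * f x)
  *-distribˡ-∑ []       k f = zeroʳ k
  *-distribˡ-∑ (x ∷ xs) k f = trans (distribˡ k _ _) (+-congˡ (*-distribˡ-∑ xs k f))

  ∑-0# : {A : Set} (xs : List A) → ∑ xs (λ _ → 0#) ≈ 0#
  ∑-0# []       = refl
  ∑-0# (x ∷ xs) = trans (+-identityˡ _) (∑-0# xs)

  ∑-comm : {A B : Set} (xs : List A) (ys : List B) (f : A → B → Carrier) →
    ∑ xs (λ x → ∑ ys (f x)) ≈ ∑ ys (λ y → ∑ xs (λ x → f x y))
  ∑-comm []       ys f = sym (∑-0# ys)
  ∑-comm (x ∷ xs) ys f = trans (+-congˡ (∑-comm xs ys f)) (sym (∑-+ ys (f x) (λ y → ∑ xs (λ x → f x y))))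

  ∑-allFin-suc : (n : ℕ) (f : Fin (suc n) → Carrier) →
    ∑ (List.allFin (suc n)) f ≡ f Fin.zero + ∑ (List.allFin n) (f ∘ Fin.suc)
  ∑-allFin-suc n f = foldr-allFin-suc n (λ i s → f i + s) 0#

  ∏-allFin-suc : (n : ℕ) (f : Fin (suc n) → Carrier) →
    ∏ (List.allFin (suc n)) f ≡ f Fin.zero * ∏ (List.allFin n) (f ∘ Fin.suc)
  ∏-allFin-suc n f = foldr-allFin-suc n (λ i s → f i * s) 1#

  ^-homo-* : (x : Carrier) (a b : ℕ) → x ^ (a ℕ.+ b) ≈ x ^ a * x ^ b
  ^-homo-* x zero    b = sym (*-identityˡ _)
  ^-homo-* x (suc a) b = trans (*-congˡ (^-homo-* x a b)) (sym (*-assoc _ _ _))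

  ∑₂ : ℕ → (ℕ → ℕ → Carrier) → Carrier
  ∑₂ zero    f = f 0 0
  ∑₂ (suc n) f = f 0 (suc n) + ∑₂ n (λ s r → f (suc s) r)

  ∑₂-cong : (n : ℕ) {f g : ℕ → ℕ → Carrier} → (∀ s r → s ℕ.+ r ≡ n → f s r ≈ g s r) → ∑₂ n f ≈ ∑₂ n g
  ∑₂-cong zero    f≈g = f≈g 0 0 ≡.refl
  ∑₂-cong (suc n) f≈g = +-cong (f≈g 0 (suc n) ≡.refl) (∑₂-cong n (λ s r e → f≈g (suc s) r (≡.cong suc e)))

  ∑₂-+ : (n : ℕ) (f g : ℕ → ℕ → Carrier) → ∑₂ n (λ s r → f s r + g s r) ≈ ∑₂ n f + ∑₂ n g
  ∑₂-+ zero    f g = refl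
  ∑₂-+ (suc n) f g = trans (+-congˡ (∑₂-+ n _ _))
    (solve 4 (λ a b c d → (a :+ b) :+ (c :+ d) := (a :+ c) :+ (b :+ d)) refl _ _ _ _)

  *-distribˡ-∑₂ : (n : ℕ) (k : Carrier) (f : ℕ → ℕ → Carrier) → k * ∑₂ n f ≈ ∑₂ n (λ s r → k * f s r)
  *-distribˡ-∑₂ zero    k f = refl
  *-distribˡ-∑₂ (suc n) k f = trans (distribˡ k _ _) (+-congˡ (*-distribˡ-∑₂ n k _))

  ∑₂-0# : (n : ℕ) → ∑₂ n (λ _ _ → 0#) ≈ 0#
  ∑₂-0# zero    = refl
  ∑₂-0# (suc n) = trans (+-identityˡ _) (∑₂-0# n)

  ∑₂-sucʳ : (n : ℕ) (f : ℕ → ℕ → Carrier) → ∑₂ (suc n) f ≈ f (suc n) 0 + ∑₂ n (λ s r → f s (suc r))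
  ∑₂-sucʳ zero    f = +-comm _ _
  ∑₂-sucʳ (suc n) f = trans (+-congˡ (∑₂-sucʳ n (λ s r → f (suc s) r)))
    (solve 3 (λ a b c → a :+ (b :+ c) := b :+ (a :+ c)) refl _ _ _)

  ∑₂-comm : (n : ℕ) (f : ℕ → ℕ → Carrier) → ∑₂ n f ≈ ∑₂ n (λ s r → f r s)
  ∑₂-comm zero    f = refl
  ∑₂-comm (suc n) f = trans (+-congˡ (∑₂-comm n (λ s r → f (suc s) r))) (sym (∑₂-sucʳ n (λ s r → f r s)))

  ∑-∑₂ : {A : Set} (xs : List A) (n : ℕ) (f : A → ℕ → ℕ → Carrier) →
    ∑ xs (λ x → ∑₂ n (f x)) ≈ ∑₂ n (λ s r → ∑ xs (λ x → f x s r))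
  ∑-∑₂ xs zero    f = refl
  ∑-∑₂ xs (suc n) f = trans (∑-+ xs _ _) (+-congˡ (∑-∑₂ xs n _))

  ∑₃ : ℕ → (ℕ → ℕ → ℕ → Carrier) → Carrier
  ∑₃ n f = ∑₂ n (λ a ρ → ∑₂ ρ (f a))

  ∑₃-cong : (n : ℕ) {f g : ℕ → ℕ → ℕ → Carrier} →
    (∀ a b c → a ℕ.+ (b ℕ.+ c) ≡ n → f a b c ≈ g a b c) → ∑₃ n f ≈ ∑₃ n g
  ∑₃-cong n f≈g = ∑₂-cong n (λ a ρ e → ∑₂-cong ρ (λ b c e′ → f≈g a b c (≡.trans (≡.cong (a ℕ.+_) e′) e)))

  ∑₃-+ : (n : ℕ) (f g : ℕ → ℕ → ℕ → Carrier) → ∑₃ n (λ a b c → f a b c + g a b c) ≈ ∑₃ n f + ∑₃ n g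
  ∑₃-+ n f g = trans (∑₂-cong n (λ a ρ _ → ∑₂-+ ρ _ _)) (∑₂-+ n _ _)

  ∑₃-assoc : (n : ℕ) (f : ℕ → ℕ → ℕ → Carrier) → ∑₃ n f ≈ ∑₂ n (λ σ c → ∑₂ σ (λ a b → f a b c))
  ∑₃-assoc zero    f = refl
  ∑₃-assoc (suc n) f = begin
    ∑₂ (suc n) (f 0) + ∑₃ n (f ∘ suc)
      ≈⟨ +-congˡ (∑₃-assoc n (f ∘ suc)) ⟩
    (f 0 0 (suc n) + ∑₂ n (λ s r → f 0 (suc s) r)) + ∑₂ n (λ σ c → ∑₂ σ (λ a b → f (suc a) b c))
      ≈⟨ +-assoc _ _ _ ⟩
    f 0 0 (suc n) + (∑₂ n (λ s r → f 0 (suc s) r) + ∑₂ n (λ σ c → ∑₂ σ (λ a b → f (suc a) b c)))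
      ≈⟨ +-congˡ (sym (∑₂-+ n _ _)) ⟩
    ∑₂ (suc n) (λ σ c → ∑₂ σ (λ a b → f a b c)) ∎

  ∑₃-swap : (n : ℕ) (f : ℕ → ℕ → ℕ → Carrier) → ∑₃ n f ≈ ∑₃ n (λ b a c → f a b c)
  ∑₃-swap n f = begin
    ∑₃ n f                                      ≈⟨ ∑₃-assoc n f ⟩
    ∑₂ n (λ σ c → ∑₂ σ (λ a b → f a b c))       ≈⟨ ∑₂-cong n (λ σ c _ → ∑₂-comm σ (λ a b → f a b c)) ⟩
    ∑₂ n (λ σ c → ∑₂ σ (λ b a → f a b c))       ≈⟨ ∑₃-assoc n (λ b a c → f a b c) ⟨
    ∑₃ n (λ b a c → f a b c)                    ∎

  module PascalConvolution (c′ : ℕ → ℕ → Carrier) (α β : ℕ → Carrier) (u : Carrier) (Y : ℕ → Carrier)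
    (c′-zeroˡ : ∀ r → c′ 0 r ≈ 1#) (c′-zeroʳ : ∀ s → c′ s 0 ≈ 1#) (α-zero : α 0 ≈ 1#) (β-zero : β 0 ≈ 1#)
    (c′-pascal : ∀ s r → c′ (suc s) (suc r) ≈ α (suc r) * c′ s (suc r) + β (suc s) * c′ (suc s) r) where

    ∑₂-pascal : ∀ n → ∑₂ (suc n) (λ s r → c′ s r * (u ^ s * Y r))
      ≈ u * ∑₂ n (λ s r → α r * c′ s r * (u ^ s * Y r)) + ∑₂ n (λ s r → β s * c′ s r * (u ^ s * Y (suc r)))
    ∑₂-pascal n = begin
      ∑₂ (suc n) (λ s r → c′ s r * (u ^ s * Y r))                ≈⟨ ∑₂-cong (suc n) split ⟩
      ∑₂ (suc n) (λ s r → left s r + right s r)                 ≈⟨ ∑₂-+ (suc n) left right ⟩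
      (0# + ∑₂ n (left ∘ suc)) + ∑₂ (suc n) right
        ≈⟨ +-cong (trans (+-identityˡ _) (sym (*-distribˡ-∑₂ n u _))) (trans (∑₂-sucʳ n right) (+-identityˡ _)) ⟩
      u * ∑₂ n (λ s r → α r * c′ s r * (u ^ s * Y r)) + ∑₂ n (λ s r → β s * c′ s r * (u ^ s * Y (suc r))) ∎
      where
      left : ℕ → ℕ → Carrier
      left zero    r = 0#
      left (suc s) r = u * (α r * c′ s r * (u ^ s * Y r))

      right : ℕ → ℕ → Carrier
      right s zero    = 0#
      right s (suc r) = β s * c′ s r * (u ^ s * Y (suc r))

      split : ∀ s r → s ℕ.+ r ≡ suc n → c′ s r * (u ^ s * Y r) ≈ left s r + right s r
      split zero zero ()
      split zero (suc r) _ = begin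
        c′ 0 (suc r) * (1# * Y (suc r))       ≈⟨ *-congʳ (c′-zeroˡ (suc r)) ⟩
        1# * (1# * Y (suc r))
          ≈⟨ solve 1 (λ y → con 1 :* (con 1 :* y) := con 0 :+ con 1 :* con 1 :* (con 1 :* y)) refl (Y (suc r)) ⟩
        0# + 1# * 1# * (1# * Y (suc r))       ≈⟨ +-congˡ (*-congʳ (*-cong β-zero (c′-zeroˡ r))) ⟨
        0# + β 0 * c′ 0 r * (1# * Y (suc r))  ∎
      split (suc s) zero _ = begin
        c′ (suc s) 0 * (u * u ^ s * Y 0)      ≈⟨ *-congʳ (c′-zeroʳ (suc s)) ⟩
        1# * (u * u ^ s * Y 0)
          ≈⟨ solve 3 (λ u p y → con 1 :* (u :* p :* y) := u :* (con 1 :* con 1 :* (p :* y)) :+ con 0) refl u (u ^ s) (Y 0) ⟩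
        u * (1# * 1# * (u ^ s * Y 0)) + 0#    ≈⟨ +-congʳ (*-congˡ (*-congʳ (*-cong α-zero (c′-zeroʳ s)))) ⟨
        u * (α 0 * c′ s 0 * (u ^ s * Y 0)) + 0# ∎
      split (suc s) (suc r) _ = begin
        c′ (suc s) (suc r) * (u * u ^ s * Y (suc r))
          ≈⟨ *-congʳ (c′-pascal s r) ⟩
        (α (suc r) * c′ s (suc r) + β (suc s) * c′ (suc s) r) * (u * u ^ s * Y (suc r))
          ≈⟨ solve 7 (λ a A b B u p y → (a :* A :+ b :* B) :* (u :* p :* y) := u :* (a :* A :* (p :* y)) :+ b :* B :* (u :* p :* y))
                     refl (α (suc r)) (c′ s (suc r)) (β (suc s)) (c′ (suc s) r) u (u ^ s) (Y (suc r)) ⟩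
        u * (α (suc r) * c′ s (suc r) * (u ^ s * Y (suc r))) + β (suc s) * c′ (suc s) r * (u * u ^ s * Y (suc r)) ∎

  -- Elementary symmetric functions

  shift : Carrier → (ℕ → Carrier) → ℕ → Carrier
  shift u f zero    = 0#
  shift u f (suc r) = u * f r

  if-then-0#-cong : ∀ b {x y : Carrier} → x ≈ y → (if b then x else 0#) ≈ (if b then y else 0#)
  if-then-0#-cong true  x≈y = x≈y
  if-then-0#-cong false x≈y = refl

  if-then-0#-* : ∀ b (x y : Carrier) → (if b then x * y else 0#) ≈ x * (if b then y else 0#)
  if-then-0#-* true  x y = refl
  if-then-0#-* false x y = sym (zeroʳ x)

  e-suc-vars : (m : ℕ) (z : Fin (suc m) → Carrier) (r : ℕ) →
    e R (suc m) z r ≈ e R m (z ∘ Fin.suc) r + shift (z Fin.zero) (e R m (z ∘ Fin.suc)) r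
  e-suc-vars m z r = begin
    e R (suc m) z r                                                    ≈⟨ ∑-concatMap _ (allSubsets m) _ ⟩
    ∑ (allSubsets m) (λ S → term (suc m) z r (true ∷ S) + (term (suc m) z r (false ∷ S) + 0#))
      ≈⟨ ∑-cong (allSubsets m) (λ S → trans (+-cong (with-zero r S) (trans (+-identityʳ _) (without-zero S))) (+-comm _ _)) ⟩
    ∑ (allSubsets m) (λ S → term m z′ r S + shift z₀ (λ r′ → term m z′ r′ S) r) ≈⟨ ∑-+ (allSubsets m) _ _ ⟩
    e R m z′ r + ∑ (allSubsets m) (λ S → shift z₀ (λ r′ → term m z′ r′ S) r) ≈⟨ +-congˡ (∑-shift r) ⟩
    e R m z′ r + shift z₀ (e R m z′) r                                 ∎
    where
    z₀ = z Fin.zero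
    z′ = z ∘ Fin.suc

    term : (k : ℕ) → (Fin k → Carrier) → ℕ → Subset k → Carrier
    term k x r S = if does (∣ S ∣ ℕ.≟ r) then ∏ (List.allFin k) (λ i → if lookup S i then x i else 1#) else 0#

    with-zero : ∀ r S → term (suc m) z r (true ∷ S) ≈ shift z₀ (λ r′ → term m z′ r′ S) r
    with-zero zero    S = refl
    with-zero (suc r) S = trans (if-then-0#-cong (does (∣ S ∣ ℕ.≟ r)) (reflexive (∏-allFin-suc m _)))
                                (if-then-0#-* (does (∣ S ∣ ℕ.≟ r)) z₀ _)

    without-zero : ∀ S → term (suc m) z r (false ∷ S) ≈ term m z′ r S
    without-zero S = if-then-0#-cong (does (∣ S ∣ ℕ.≟ r)) (trans (reflexive (∏-allFin-suc m _)) (*-identityˡ _))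

    ∑-shift : ∀ r → ∑ (allSubsets m) (λ S → shift z₀ (λ r′ → term m z′ r′ S) r) ≈ shift z₀ (e R m z′) r
    ∑-shift zero    = ∑-0# (allSubsets m)
    ∑-shift (suc r) = sym (*-distribˡ-∑ (allSubsets m) z₀ (term m z′ r))

  e-zero : (m : ℕ) (z : Fin m → Carrier) → e R m z 0 ≈ 1#
  e-zero zero    z = +-identityʳ _
  e-zero (suc m) z = trans (e-suc-vars m z 0) (trans (+-identityʳ _) (e-zero m _))

  e-no-vars : (z : Fin 0 → Carrier) (r : ℕ) → e R 0 z (suc r) ≈ 0#
  e-no-vars z r = +-identityʳ 0#

  -- Gaussian binomials

  module _ (t : Carrier) where

    t^_−1 : ℕ → Carrier
    t^ j −1 = t ^ j - 1#

    t^−1+1 : ∀ j → t^ j −1 + 1# ≈ t ^ j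
    t^−1+1 j = begin
      (t ^ j - 1#) + 1#     ≈⟨ +-assoc _ _ _ ⟩
      t ^ j + (- 1# + 1#)   ≈⟨ +-congˡ (-‿inverseˡ 1#) ⟩
      t ^ j + 0#            ≈⟨ +-identityʳ _ ⟩
      t ^ j                 ∎

    t^−1-homo : ∀ a b → t^ (a ℕ.+ b) −1 ≈ t^ a −1 + t ^ a * t^ b −1
    t^−1-homo a b = ∙-cancelʳ 1# _ _ (begin
      t^ (a ℕ.+ b) −1 + 1#               ≈⟨ t^−1+1 (a ℕ.+ b) ⟩
      t ^ (a ℕ.+ b)                      ≈⟨ ^-homo-* t a b ⟩
      t ^ a * t ^ b                      ≈⟨ *-cong (t^−1+1 a) (t^−1+1 b) ⟨
      (t^ a −1 + 1#) * (t^ b −1 + 1#)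
        ≈⟨ solve 2 (λ x y → (x :+ con 1) :* (y :+ con 1) := (x :+ (x :+ con 1) :* y) :+ con 1) refl (t^ a −1) (t^ b −1) ⟩
      (t^ a −1 + (t^ a −1 + 1#) * t^ b −1) + 1#
        ≈⟨ +-congʳ (+-congˡ (*-congʳ (t^−1+1 a))) ⟩
      (t^ a −1 + t ^ a * t^ b −1) + 1#   ∎)

    -- the Gaussian binomial coefficient [s + r choose s] in t
    gauss : ℕ → ℕ → Carrier
    gauss zero    r       = 1#
    gauss (suc s) zero    = 1#
    gauss (suc s) (suc r) = t ^ suc r * gauss s (suc r) + gauss (suc s) r

    gauss-zeroʳ : ∀ s → gauss s 0 ≈ 1#
    gauss-zeroʳ zero    = refl
    gauss-zeroʳ (suc s) = refl

    gauss-pascal : ∀ s r → gauss (suc s) (suc r) ≈ gauss s (suc r) + t ^ suc s * gauss (suc s) r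
    gauss-pascal zero zero = +-comm _ _
    gauss-pascal zero (suc r) = begin
      t ^ suc (suc r) * 1# + gauss 1 (suc r)           ≈⟨ +-congˡ (gauss-pascal zero r) ⟩
      t ^ suc (suc r) * 1# + (1# + (t * 1#) * gauss 1 r)
        ≈⟨ solve 3 (λ t p G → (t :* p) :* con 1 :+ (con 1 :+ (t :* con 1) :* G) := con 1 :+ (t :* con 1) :* (p :* con 1 :+ G))
                   refl t (t ^ suc r) (gauss 1 r) ⟩
      1# + (t * 1#) * (t ^ suc r * 1# + gauss 1 r)     ∎
    gauss-pascal (suc s) zero = begin
      (t * 1#) * gauss (suc s) 1 + 1#                  ≈⟨ +-congʳ (*-congˡ (gauss-pascal s zero)) ⟩
      (t * 1#) * (gauss s 1 + t ^ suc s * 1#) + 1#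
        ≈⟨ solve 3 (λ t G p → (t :* con 1) :* (G :+ p :* con 1) :+ con 1 := ((t :* con 1) :* G :+ con 1) :+ (t :* p) :* con 1)
                   refl t (gauss s 1) (t ^ suc s) ⟩
      ((t * 1#) * gauss s 1 + 1#) + t ^ suc (suc s) * 1# ∎
    gauss-pascal (suc s) (suc r) = begin
      t ^ suc (suc r) * gauss (suc s) (suc (suc r)) + gauss (suc (suc s)) (suc r)
        ≈⟨ +-cong (*-congˡ (gauss-pascal s (suc r))) (gauss-pascal (suc s) r) ⟩
      t ^ suc (suc r) * (gauss s (suc (suc r)) + t ^ suc s * gauss (suc s) (suc r))
        + (gauss (suc s) (suc r) + t ^ suc (suc s) * gauss (suc (suc s)) r)
        ≈⟨ solve 6 (λ t a b A B D → (t :* b) :* (A :+ a :* B) :+ (B :+ (t :* a) :* D)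
                                    := ((t :* b) :* A :+ B) :+ (t :* a) :* (b :* B :+ D))
                   refl t (t ^ suc s) (t ^ suc r) (gauss s (suc (suc r))) (gauss (suc s) (suc r)) (gauss (suc (suc s)) r) ⟩
      (t ^ suc (suc r) * gauss s (suc (suc r)) + gauss (suc s) (suc r))
        + t ^ suc (suc s) * (t ^ suc r * gauss (suc s) (suc r) + gauss (suc (suc s)) r) ∎

    -- Subtracting the two Pascal rules from each other.
    gauss-absorb-swap : ∀ s r → t^ suc r −1 * gauss s (suc r) ≈ t^ suc s −1 * gauss (suc s) r
    gauss-absorb-swap s r = ∙-cancelʳ (A + B) _ _ (begin
      t^ suc r −1 * A + (A + B)      ≈⟨ solve 3 (λ n A B → n :* A :+ (A :+ B) := (n :+ con 1) :* A :+ B) refl (t^ suc r −1) A B ⟩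
      (t^ suc r −1 + 1#) * A + B     ≈⟨ +-congʳ (*-congʳ (t^−1+1 (suc r))) ⟩
      t ^ suc r * A + B              ≈⟨ gauss-pascal s r ⟩
      A + t ^ suc s * B              ≈⟨ +-congˡ (*-congʳ (t^−1+1 (suc s))) ⟨
      A + (t^ suc s −1 + 1#) * B     ≈⟨ solve 3 (λ n A B → A :+ (n :+ con 1) :* B := n :* B :+ (A :+ B)) refl (t^ suc s −1) A B ⟩
      t^ suc s −1 * B + (A + B)      ∎)
      where A = gauss s (suc r)
            B = gauss (suc s) r

    gauss-absorbʳ : ∀ s r → t^ suc r −1 * gauss s (suc r) ≈ t^ suc (s ℕ.+ r) −1 * gauss s r
    gauss-absorbʳ zero    r = refl
    gauss-absorbʳ (suc s) r = begin
      t^ suc r −1 * gauss (suc s) (suc r)                  ≈⟨ *-congˡ (gauss-pascal s r) ⟩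
      t^ suc r −1 * (gauss s (suc r) + a * G)
        ≈⟨ solve 4 (λ n A a G → n :* (A :+ a :* G) := n :* A :+ a :* (n :* G)) refl (t^ suc r −1) (gauss s (suc r)) a G ⟩
      t^ suc r −1 * gauss s (suc r) + a * (t^ suc r −1 * G)  ≈⟨ +-congʳ (gauss-absorb-swap s r) ⟩
      t^ suc s −1 * G + a * (t^ suc r −1 * G)
        ≈⟨ solve 4 (λ m a n G → m :* G :+ a :* (n :* G) := (m :+ a :* n) :* G) refl (t^ suc s −1) a (t^ suc r −1) G ⟩
      (t^ suc s −1 + a * t^ suc r −1) * G                  ≈⟨ *-congʳ (t^−1-homo (suc s) (suc r)) ⟨
      t^ suc s ℕ.+ suc r −1 * G                            ≈⟨ reflexive (≡.cong (λ j → t^ suc j −1 * G) (ℕₚ.+-suc s r)) ⟩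
      t^ suc (suc s ℕ.+ r) −1 * G                          ∎
      where a = t ^ suc s
            G = gauss (suc s) r

    gauss-absorbˡ : ∀ s r → t^ suc s −1 * gauss (suc s) r ≈ t^ suc (s ℕ.+ r) −1 * gauss s r
    gauss-absorbˡ s r = trans (sym (gauss-absorb-swap s r)) (gauss-absorbʳ s r)

    pochhammer : ℕ → ℕ → Carrier
    pochhammer a zero    = 1#
    pochhammer a (suc β) = t^ suc a −1 * pochhammer (suc a) β

    pochhammer-snoc : ∀ a β → pochhammer a (suc β) ≈ pochhammer a β * t^ suc (a ℕ.+ β) −1
    pochhammer-snoc a zero = trans (*-comm _ _) (*-congˡ (reflexive (≡.cong (λ j → t^ suc j −1) (≡.sym (ℕₚ.+-identityʳ a)))))
    pochhammer-snoc a (suc β) = begin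
      t^ suc a −1 * pochhammer (suc a) (suc β)                  ≈⟨ *-congˡ (pochhammer-snoc (suc a) β) ⟩
      t^ suc a −1 * (pochhammer (suc a) β * t^ suc (suc a ℕ.+ β) −1) ≈⟨ *-assoc _ _ _ ⟨
      pochhammer a (suc β) * t^ suc (suc a ℕ.+ β) −1
        ≈⟨ *-congˡ (reflexive (≡.cong (λ j → t^ suc j −1) (≡.sym (ℕₚ.+-suc a β)))) ⟩
      pochhammer a (suc β) * t^ suc (a ℕ.+ suc β) −1           ∎

    gauss-pochhammer : ∀ s β r → gauss s (β ℕ.+ r) * pochhammer r β ≈ pochhammer (s ℕ.+ r) β * gauss s r
    gauss-pochhammer s zero    r = *-comm _ _
    gauss-pochhammer s (suc β) r = begin
      gauss s (suc (β ℕ.+ r)) * pochhammer r (suc β)             ≈⟨ *-congˡ (pochhammer-snoc r β) ⟩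
      gauss s (suc (β ℕ.+ r)) * (pochhammer r β * t^ suc (r ℕ.+ β) −1)
        ≈⟨ *-congˡ (*-congˡ (reflexive (≡.cong (λ j → t^ suc j −1) (ℕₚ.+-comm r β)))) ⟩
      gauss s (suc (β ℕ.+ r)) * (pochhammer r β * t^ suc (β ℕ.+ r) −1)
        ≈⟨ solve 3 (λ G p n → G :* (p :* n) := (n :* G) :* p) refl _ _ _ ⟩
      (t^ suc (β ℕ.+ r) −1 * gauss s (suc (β ℕ.+ r))) * pochhammer r β ≈⟨ *-congʳ (gauss-absorbʳ s (β ℕ.+ r)) ⟩
      (t^ suc (s ℕ.+ (β ℕ.+ r)) −1 * gauss s (β ℕ.+ r)) * pochhammer r β ≈⟨ *-assoc _ _ _ ⟩
      t^ suc (s ℕ.+ (β ℕ.+ r)) −1 * (gauss s (β ℕ.+ r) * pochhammer r β)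
        ≈⟨ *-cong (reflexive (≡.cong (λ j → t^ suc j −1) s+[β+r]≡[s+r]+β)) (gauss-pochhammer s β r) ⟩
      t^ suc ((s ℕ.+ r) ℕ.+ β) −1 * (pochhammer (s ℕ.+ r) β * gauss s r)
        ≈⟨ solve 3 (λ n p G → n :* (p :* G) := (p :* n) :* G) refl _ _ _ ⟩
      (pochhammer (s ℕ.+ r) β * t^ suc ((s ℕ.+ r) ℕ.+ β) −1) * gauss s r ≈⟨ *-congʳ (pochhammer-snoc (s ℕ.+ r) β) ⟨
      pochhammer (s ℕ.+ r) (suc β) * gauss s r                    ∎
      where
      s+[β+r]≡[s+r]+β : s ℕ.+ (β ℕ.+ r) ≡ (s ℕ.+ r) ℕ.+ β
      s+[β+r]≡[s+r]+β = ≡.trans (≡.cong (s ℕ.+_) (ℕₚ.+-comm β r)) (≡.sym (ℕₚ.+-assoc s r β))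

    -- (t^s − 1) · pochhammer (s + r) β · gauss s r, written so that the s = 0 term vanishes on the nose
    excess : ℕ → ℕ → ℕ → Carrier
    excess zero    β r = 0#
    excess (suc s) β r = pochhammer (s ℕ.+ r) (suc β) * gauss s r

    t^*gauss-pochhammer : ∀ s β r →
      t ^ s * (gauss s (β ℕ.+ r) * pochhammer r β) ≈ pochhammer (s ℕ.+ r) β * gauss s r + excess s β r
    t^*gauss-pochhammer zero    β r = solve 1 (λ p → con 1 :* (con 1 :* p) := p :* con 1 :+ con 0) refl (pochhammer r β)
    t^*gauss-pochhammer (suc s) β r = begin
      t ^ suc s * (gauss (suc s) (β ℕ.+ r) * pochhammer r β)    ≈⟨ *-cong (sym (t^−1+1 (suc s))) (gauss-pochhammer (suc s) β r) ⟩
      (t^ suc s −1 + 1#) * (p * gauss (suc s) r)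
        ≈⟨ solve 3 (λ n P G → (n :+ con 1) :* (P :* G) := P :* G :+ P :* (n :* G)) refl (t^ suc s −1) p (gauss (suc s) r) ⟩
      p * gauss (suc s) r + p * (t^ suc s −1 * gauss (suc s) r)  ≈⟨ +-congˡ (*-congˡ (gauss-absorbˡ s r)) ⟩
      p * gauss (suc s) r + p * (t^ suc (s ℕ.+ r) −1 * gauss s r)
        ≈⟨ +-congˡ (solve 3 (λ P n G → P :* (n :* G) := (n :* P) :* G) refl p (t^ suc (s ℕ.+ r) −1) (gauss s r)) ⟩
      p * gauss (suc s) r + excess (suc s) β r                   ∎
      where p = pochhammer (suc s ℕ.+ r) β

    -- The recursion for LLT

    llt : (n m : ℕ) → (Fin m → Carrier) → Carrier
    llt n m z = LLT R n m z t

    llt-zero : (m : ℕ) (z : Fin m → Carrier) → llt 0 m z ≈ 1#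
    llt-zero m z = solve 0 (con 1 :* con 1 :+ con 0 := con 1) refl

    llt-cong : (n m : ℕ) {z w : Fin m → Carrier} → (∀ i → z i ≈ w i) → llt n m z ≈ llt n m w
    llt-cong n m z≈w = ∑-cong (allVecs n m) (λ κ → *-congʳ (∏-cong (List.allFin n) (λ i → z≈w (lookup κ i))))

    ∏-if-* : {A : Set} (xs : List A) (b : A → Bool) (f : A → Carrier) →
      ∏ xs (λ x → if b x then t * f x else f x) ≈ t ^ sum (map (λ x → if b x then 1 else 0) xs) * ∏ xs f
    ∏-if-* []       b f = sym (*-identityˡ _)
    ∏-if-* (x ∷ xs) b f with b x
    ... | true  = trans (*-congˡ (∏-if-* xs b f)) (solve 4 (λ t a p q → t :* a :* (p :* q) := (t :* p) :* (a :* q)) refl t (f x) _ _)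
    ... | false = trans (*-congˡ (∏-if-* xs b f)) (solve 3 (λ a p q → a :* (p :* q) := p :* (a :* q)) refl (f x) _ _)

    scaleAbove : {m : ℕ} → (Fin m → Carrier) → Fin m → Fin m → Carrier
    scaleAbove z a b = if does (a Fin.<? b) then t * z b else z b

    -- Fixing the first letter a: every later letter above a is an ascent from it.
    llt-suc : (n m : ℕ) (z : Fin m → Carrier) → llt (suc n) m z ≈ ∑ (List.allFin m) (λ a → z a * llt n m (scaleAbove z a))
    llt-suc n m z = begin
      llt (suc n) m z                                                       ≈⟨ ∑-concatMap _ (allVecs n m) _ ⟩
      ∑ (allVecs n m) (λ v → ∑ (map (_∷ v) (List.allFin m)) weight)
        ≈⟨ ∑-cong (allVecs n m) (λ v → trans (∑-map _ (List.allFin m) weight) (∑-cong (List.allFin m) (λ a → weight-∷ a v))) ⟩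
      ∑ (allVecs n m) (λ v → ∑ (List.allFin m) (λ a → z a * scaledWeight a v)) ≈⟨ ∑-comm (allVecs n m) (List.allFin m) _ ⟩
      ∑ (List.allFin m) (λ a → ∑ (allVecs n m) (λ v → z a * scaledWeight a v))
        ≈⟨ ∑-cong (List.allFin m) (λ a → sym (*-distribˡ-∑ (allVecs n m) (z a) (scaledWeight a))) ⟩
      ∑ (List.allFin m) (λ a → z a * llt n m (scaleAbove z a))              ∎
      where
      weight : Vec (Fin m) (suc n) → Carrier
      weight κ = ∏ (List.allFin (suc n)) (λ i → z (lookup κ i)) * t ^ asc κ

      scaledWeight : Fin m → Vec (Fin m) n → Carrier
      scaledWeight a v = ∏ (List.allFin n) (λ i → scaleAbove z a (lookup v i)) * t ^ asc v

      weight-∷ : ∀ a v → weight (a ∷ v) ≈ z a * scaledWeight a v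
      weight-∷ a v = begin
        ∏ (List.allFin (suc n)) (λ i → z (lookup (a ∷ v) i)) * t ^ asc (a ∷ v)
          ≈⟨ *-cong (reflexive (∏-allFin-suc n _)) (reflexive (≡.cong (t ^_) (asc-∷ a v))) ⟩
        (z a * zv) * t ^ (ascentsFrom a v ℕ.+ asc v)                ≈⟨ *-congˡ (^-homo-* t (ascentsFrom a v) (asc v)) ⟩
        (z a * zv) * (t ^ ascentsFrom a v * t ^ asc v)
          ≈⟨ solve 4 (λ za P c s → (za :* P) :* (c :* s) := za :* ((c :* P) :* s)) refl (z a) zv (t ^ ascentsFrom a v) (t ^ asc v) ⟩
        z a * ((t ^ ascentsFrom a v * zv) * t ^ asc v)
          ≈⟨ *-congˡ (*-congʳ (∏-if-* (List.allFin n) (λ i → does (a Fin.<? lookup v i)) (λ i → z (lookup v i)))) ⟨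
        z a * scaledWeight a v                                        ∎
        where zv = ∏ (List.allFin n) (λ i → z (lookup v i))

    llt-homogeneous : (n m : ℕ) (k : Carrier) (z : Fin m → Carrier) → llt n m (λ i → k * z i) ≈ k ^ n * llt n m z
    llt-homogeneous zero    m k z = trans (llt-zero m (λ i → k * z i)) (sym (trans (*-identityˡ _) (llt-zero m z)))
    llt-homogeneous (suc n) m k z = begin
      llt (suc n) m (λ i → k * z i)                                          ≈⟨ llt-suc n m _ ⟩
      ∑ (List.allFin m) (λ a → (k * z a) * llt n m (scaleAbove (λ i → k * z i) a))
        ≈⟨ ∑-cong (List.allFin m) (λ a → *-congˡ (trans (llt-cong n m (scaleAbove-* a)) (llt-homogeneous n m k (scaleAbove z a)))) ⟩
      ∑ (List.allFin m) (λ a → (k * z a) * (k ^ n * llt n m (scaleAbove z a)))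
        ≈⟨ ∑-cong (List.allFin m) (λ a → solve 4 (λ k x p l → (k :* x) :* (p :* l) := (k :* p) :* (x :* l)) refl k (z a) (k ^ n) _) ⟩
      ∑ (List.allFin m) (λ a → k ^ suc n * (z a * llt n m (scaleAbove z a)))  ≈⟨ *-distribˡ-∑ (List.allFin m) _ _ ⟨
      k ^ suc n * ∑ (List.allFin m) (λ a → z a * llt n m (scaleAbove z a))    ≈⟨ *-congˡ (llt-suc n m z) ⟨
      k ^ suc n * llt (suc n) m z                                            ∎
      where
      scaleAbove-* : ∀ a i → scaleAbove (λ i → k * z i) a i ≈ k * scaleAbove z a i
      scaleAbove-* a i with does (a Fin.<? i)
      ... | true  = solve 3 (λ t k x → t :* (k :* x) := k :* (t :* x)) refl t k (z i)
      ... | false = refl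

    -- gauss s r is the t-count of the interleavings of s letters z₀ with r larger letters.
    llt-suc-vars : (n m : ℕ) (z : Fin (suc m) → Carrier) →
      llt n (suc m) z ≈ ∑₂ n (λ s r → gauss s r * (z Fin.zero ^ s * llt r m (z ∘ Fin.suc)))
    llt-suc-vars zero    m z = trans (llt-zero (suc m) z) (sym (trans (*-identityˡ _) (trans (*-identityˡ _) (llt-zero m (z ∘ Fin.suc)))))
    llt-suc-vars (suc n) m z = begin
      llt (suc n) (suc m) z                                         ≈⟨ llt-suc n (suc m) z ⟩
      ∑ (List.allFin (suc m)) (λ a → z a * llt n (suc m) (scaleAbove z a)) ≈⟨ reflexive (∑-allFin-suc m _) ⟩
      z₀ * llt n (suc m) (scaleAbove z Fin.zero) + ∑ (List.allFin m) (λ a → z′ a * llt n (suc m) (scaleAbove z (Fin.suc a)))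
        ≈⟨ +-cong first-is-z₀ first-in-z′ ⟩
      z₀ * ∑₂ n (λ s r → t ^ r * gauss s r * (z₀ ^ s * Y r)) + ∑₂ n (λ s r → 1# * gauss s r * (z₀ ^ s * Y (suc r)))
        ≈⟨ ∑₂-pascal n ⟨
      ∑₂ (suc n) (λ s r → gauss s r * (z₀ ^ s * Y r))                 ∎
      where
      z₀ = z Fin.zero
      z′ = z ∘ Fin.suc
      Y : ℕ → Carrier
      Y r = llt r m z′
      open PascalConvolution gauss (t ^_) (λ _ → 1#) z₀ Y (λ _ → refl) gauss-zeroʳ refl refl
             (λ s r → +-congˡ (sym (*-identityˡ _)))

      first-is-z₀ : z₀ * llt n (suc m) (scaleAbove z Fin.zero) ≈ z₀ * ∑₂ n (λ s r → t ^ r * gauss s r * (z₀ ^ s * Y r))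
      first-is-z₀ = *-congˡ (trans (llt-suc-vars n m (scaleAbove z Fin.zero)) (∑₂-cong n (λ s r _ →
        trans (*-congˡ (*-congˡ (llt-homogeneous r m t z′)))
              (solve 4 (λ G p a l → G :* (p :* (a :* l)) := a :* G :* (p :* l)) refl (gauss s r) (z₀ ^ s) (t ^ r) (Y r)))))

      first-in-z′ : ∑ (List.allFin m) (λ a → z′ a * llt n (suc m) (scaleAbove z (Fin.suc a)))
                  ≈ ∑₂ n (λ s r → 1# * gauss s r * (z₀ ^ s * Y (suc r)))
      first-in-z′ = begin
        ∑ (List.allFin m) (λ a → z′ a * llt n (suc m) (scaleAbove z (Fin.suc a)))
          ≈⟨ ∑-cong (List.allFin m) (λ a → trans (*-congˡ (llt-suc-vars n m (scaleAbove z (Fin.suc a))))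
                                                 (*-distribˡ-∑₂ n (z′ a) _)) ⟩
        ∑ (List.allFin m) (λ a → ∑₂ n (λ s r → z′ a * (gauss s r * (z₀ ^ s * llt r m (scaleAbove z′ a)))))
          ≈⟨ ∑-∑₂ (List.allFin m) n _ ⟩
        ∑₂ n (λ s r → ∑ (List.allFin m) (λ a → z′ a * (gauss s r * (z₀ ^ s * llt r m (scaleAbove z′ a)))))
          ≈⟨ ∑₂-cong n (λ s r _ → pull-out s r) ⟩
        ∑₂ n (λ s r → 1# * gauss s r * (z₀ ^ s * Y (suc r))) ∎
        where
        pull-out : ∀ s r → ∑ (List.allFin m) (λ a → z′ a * (gauss s r * (z₀ ^ s * llt r m (scaleAbove z′ a))))
                         ≈ 1# * gauss s r * (z₀ ^ s * Y (suc r))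
        pull-out s r = begin
          ∑ (List.allFin m) (λ a → z′ a * (gauss s r * (z₀ ^ s * llt r m (scaleAbove z′ a))))
            ≈⟨ ∑-cong (List.allFin m) (λ a → solve 4 (λ x G p l → x :* (G :* (p :* l)) := (G :* p) :* (x :* l))
                                                    refl (z′ a) (gauss s r) (z₀ ^ s) (llt r m (scaleAbove z′ a))) ⟩
          ∑ (List.allFin m) (λ a → (gauss s r * z₀ ^ s) * (z′ a * llt r m (scaleAbove z′ a)))
            ≈⟨ *-distribˡ-∑ (List.allFin m) _ _ ⟨
          (gauss s r * z₀ ^ s) * ∑ (List.allFin m) (λ a → z′ a * llt r m (scaleAbove z′ a))   ≈⟨ *-congˡ (llt-suc r m z′) ⟨
          (gauss s r * z₀ ^ s) * Y (suc r)
            ≈⟨ solve 3 (λ G p y → (G :* p) :* y := con 1 :* G :* (p :* y)) refl (gauss s r) (z₀ ^ s) (Y (suc r)) ⟩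
          1# * gauss s r * (z₀ ^ s * Y (suc r))                                              ∎

    LLTRecursion : (ℕ → Carrier) → (ℕ → Carrier) → Set ℓ
    LLTRecursion e X = ∀ n → X (suc n) ≈ ∑₂ n (λ β ρ → pochhammer ρ β * (e (suc β) * X ρ))

    module AdjoinVariable (u : Carrier) (Y e′ : ℕ → Carrier) (Y-rec : LLTRecursion e′ Y) (e′-zero : e′ 0 ≈ 1#) where

      C : ℕ → Carrier
      C n = ∑₂ n (λ s r → gauss s r * (u ^ s * Y r))

      open PascalConvolution gauss (λ _ → 1#) (t ^_) u Y (λ _ → refl) gauss-zeroʳ refl refl
             (λ s r → trans (gauss-pascal s r) (+-congʳ (sym (*-identityˡ _))))

      expanded main correction : ℕ → ℕ → ℕ → Carrier
      expanded s β r = t ^ s * gauss s (β ℕ.+ r) * (u ^ s * (pochhammer r β * (e′ (suc β) * Y r)))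
      main s β r = pochhammer (s ℕ.+ r) β * (e′ (suc β) * (gauss s r * (u ^ s * Y r)))
      correction zero    β r = 0#
      correction (suc s) β r = pochhammer (s ℕ.+ r) (suc β) * (u * e′ (suc β) * (gauss s r * (u ^ s * Y r)))

      expand : ∀ n → ∑₂ n (λ s r → t ^ s * gauss s r * (u ^ s * Y (suc r))) ≈ ∑₃ n expanded
      expand n = ∑₂-cong n (λ s r′ _ → begin
        t ^ s * gauss s r′ * (u ^ s * Y (suc r′))
          ≈⟨ solve 4 (λ a G p y → a :* G :* (p :* y) := (a :* G :* p) :* y) refl (t ^ s) (gauss s r′) (u ^ s) (Y (suc r′)) ⟩
        (t ^ s * gauss s r′ * u ^ s) * Y (suc r′)         ≈⟨ *-congˡ (Y-rec r′) ⟩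
        (t ^ s * gauss s r′ * u ^ s) * ∑₂ r′ (λ β ρ → pochhammer ρ β * (e′ (suc β) * Y ρ)) ≈⟨ *-distribˡ-∑₂ r′ _ _ ⟩
        ∑₂ r′ (λ β ρ → (t ^ s * gauss s r′ * u ^ s) * (pochhammer ρ β * (e′ (suc β) * Y ρ)))
          ≈⟨ ∑₂-cong r′ (λ { β ρ ≡.refl →
               solve 6 (λ a G p P e y → (a :* G :* p) :* (P :* (e :* y)) := a :* G :* (p :* (P :* (e :* y))))
                                          refl (t ^ s) (gauss s (β ℕ.+ ρ)) (u ^ s) (pochhammer ρ β) (e′ (suc β)) (Y ρ) }) ⟩
        ∑₂ r′ (expanded s)                                ∎)

      expanded≈main+correction : ∀ s β r → expanded s β r ≈ main s β r + correction s β r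
      expanded≈main+correction s β r = begin
        t ^ s * gauss s (β ℕ.+ r) * (u ^ s * (pochhammer r β * x))
          ≈⟨ solve 5 (λ a G p P x → a :* G :* (p :* (P :* x)) := (a :* (G :* P)) :* (p :* x))
                     refl (t ^ s) (gauss s (β ℕ.+ r)) (u ^ s) (pochhammer r β) x ⟩
        (t ^ s * (gauss s (β ℕ.+ r) * pochhammer r β)) * (u ^ s * x) ≈⟨ *-congʳ (t^*gauss-pochhammer s β r) ⟩
        (pochhammer (s ℕ.+ r) β * gauss s r + excess s β r) * (u ^ s * x) ≈⟨ distribʳ _ _ _ ⟩
        pochhammer (s ℕ.+ r) β * gauss s r * (u ^ s * x) + excess s β r * (u ^ s * x)
          ≈⟨ +-cong (solve 5 (λ P G p e y → P :* G :* (p :* (e :* y)) := P :* (e :* (G :* (p :* y))))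
                             refl (pochhammer (s ℕ.+ r) β) (gauss s r) (u ^ s) (e′ (suc β)) (Y r))
                    (excess≈correction s) ⟩
        main s β r + correction s β r                            ∎
        where
        x = e′ (suc β) * Y r
        excess≈correction : ∀ s → excess s β r * (u ^ s * x) ≈ correction s β r
        excess≈correction zero    = zeroˡ _
        excess≈correction (suc s) = solve 6 (λ P G u p e y → P :* G :* (u :* p :* (e :* y)) := P :* (u :* e :* (G :* (p :* y))))
          refl (pochhammer (s ℕ.+ r) (suc β)) (gauss s r) u (u ^ s) (e′ (suc β)) (Y r)

      ∑₃-main : ∀ n → ∑₂ n (λ β ρ → pochhammer ρ β * (e′ (suc β) * C ρ)) ≈ ∑₃ n main
      ∑₃-main n = begin
        ∑₂ n (λ β ρ → pochhammer ρ β * (e′ (suc β) * C ρ))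
          ≈⟨ ∑₂-cong n (λ β ρ _ → trans (sym (*-assoc _ _ _)) (*-distribˡ-∑₂ ρ _ _)) ⟩
        ∑₂ n (λ β ρ → ∑₂ ρ (λ s r → (pochhammer ρ β * e′ (suc β)) * (gauss s r * (u ^ s * Y r))))
          ≈⟨ ∑₂-cong n (λ β ρ _ → ∑₂-cong ρ (λ { s r ≡.refl → *-assoc _ _ _ })) ⟩
        ∑₃ n (λ β s r → main s β r)                    ≈⟨ ∑₃-swap n (λ β s r → main s β r) ⟩
        ∑₃ n main                                      ∎

      ∑₃-correction : ∀ n → ∑₂ n (λ β ρ → pochhammer ρ β * (u * e′ β * C ρ)) ≈ u * C n + ∑₃ n correction
      ∑₃-correction zero = begin
        1# * (u * e′ 0 * C 0)          ≈⟨ *-congˡ (*-congʳ (*-congˡ e′-zero)) ⟩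
        1# * (u * 1# * C 0)            ≈⟨ solve 2 (λ u x → con 1 :* (u :* con 1 :* x) := u :* x :+ con 0) refl u (C 0) ⟩
        u * C 0 + 0#                   ∎
      ∑₃-correction (suc n) = begin
        1# * (u * e′ 0 * C (suc n)) + ∑₂ n (λ β ρ → pochhammer ρ (suc β) * (u * e′ (suc β) * C ρ))
          ≈⟨ +-cong (trans (*-congˡ (*-congʳ (*-congˡ e′-zero)))
                           (solve 2 (λ u x → con 1 :* (u :* con 1 :* x) := u :* x) refl u (C (suc n))))
                    correction-terms ⟩
        u * C (suc n) + (0# + ∑₃ n (correction ∘ suc))  ≈⟨ +-congˡ (+-congʳ (∑₂-0# (suc n))) ⟨
        u * C (suc n) + ∑₃ (suc n) correction          ∎
        where
        correction-terms : ∑₂ n (λ β ρ → pochhammer ρ (suc β) * (u * e′ (suc β) * C ρ)) ≈ 0# + ∑₃ n (correction ∘ suc)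
        correction-terms = begin
          ∑₂ n (λ β ρ → pochhammer ρ (suc β) * (u * e′ (suc β) * C ρ))
            ≈⟨ ∑₂-cong n (λ β ρ _ → trans (sym (*-assoc _ _ _)) (*-distribˡ-∑₂ ρ _ _)) ⟩
          ∑₂ n (λ β ρ → ∑₂ ρ (λ s r → (pochhammer ρ (suc β) * (u * e′ (suc β))) * (gauss s r * (u ^ s * Y r))))
            ≈⟨ ∑₂-cong n (λ β ρ _ → ∑₂-cong ρ (λ { s r ≡.refl → *-assoc _ _ _ })) ⟩
          ∑₃ n (λ β s r → correction (suc s) β r)     ≈⟨ ∑₃-swap n (λ β s r → correction (suc s) β r) ⟩
          ∑₃ n (correction ∘ suc)                      ≈⟨ +-identityˡ _ ⟨
          0# + ∑₃ n (correction ∘ suc)                 ∎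

      C-rec : LLTRecursion (λ r → e′ r + shift u e′ r) C
      C-rec n = begin
        C (suc n)                                                     ≈⟨ ∑₂-pascal n ⟩
        u * ∑₂ n (λ s r → 1# * gauss s r * (u ^ s * Y r)) + ∑₂ n (λ s r → t ^ s * gauss s r * (u ^ s * Y (suc r)))
          ≈⟨ +-cong (*-congˡ (∑₂-cong n (λ s r _ → *-congʳ (*-identityˡ _)))) (expand n) ⟩
        u * C n + ∑₃ n expanded
          ≈⟨ +-congˡ (trans (∑₃-cong n (λ s β r _ → expanded≈main+correction s β r)) (∑₃-+ n main correction)) ⟩
        u * C n + (∑₃ n main + ∑₃ n correction)
          ≈⟨ solve 3 (λ a b c → a :+ (b :+ c) := b :+ (a :+ c)) refl (u * C n) (∑₃ n main) (∑₃ n correction) ⟩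
        ∑₃ n main + (u * C n + ∑₃ n correction)                       ≈⟨ +-cong (∑₃-main n) (∑₃-correction n) ⟨
        ∑₂ n (λ β ρ → pochhammer ρ β * (e′ (suc β) * C ρ)) + ∑₂ n (λ β ρ → pochhammer ρ β * (u * e′ β * C ρ))
          ≈⟨ ∑₂-+ n _ _ ⟨
        ∑₂ n (λ β ρ → pochhammer ρ β * (e′ (suc β) * C ρ) + pochhammer ρ β * (u * e′ β * C ρ))
          ≈⟨ ∑₂-cong n (λ β ρ _ → solve 4 (λ P e f c → P :* (e :* c) :+ P :* (f :* c) := P :* ((e :+ f) :* c))
                                          refl (pochhammer ρ β) (e′ (suc β)) (u * e′ β) (C ρ)) ⟩
        ∑₂ n (λ β ρ → pochhammer ρ β * ((e′ (suc β) + u * e′ β) * C ρ)) ∎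

    llt-rec : (m : ℕ) (z : Fin m → Carrier) → LLTRecursion (e R m z) (λ n → llt n m z)
    llt-rec zero    z n = trans (llt-suc n 0 z) (sym (trans (∑₂-cong n vanishes) (∑₂-0# n)))
      where
      vanishes : ∀ β ρ → β ℕ.+ ρ ≡ n → pochhammer ρ β * (e R 0 z (suc β) * llt ρ 0 z) ≈ 0#
      vanishes β ρ _ = trans (*-congˡ (trans (*-congʳ (e-no-vars z β)) (zeroˡ _))) (zeroʳ _)
    llt-rec (suc m) z n = begin
      llt (suc n) (suc m) z                                          ≈⟨ llt-suc-vars (suc n) m z ⟩
      C (suc n)                                                      ≈⟨ C-rec n ⟩
      ∑₂ n (λ β ρ → pochhammer ρ β * ((e R m z′ (suc β) + z Fin.zero * e R m z′ β) * C ρ))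
        ≈⟨ ∑₂-cong n (λ β ρ _ → *-congˡ (*-cong (e-suc-vars m z (suc β)) (llt-suc-vars ρ m z))) ⟨
      ∑₂ n (λ β ρ → pochhammer ρ β * (e R (suc m) z (suc β) * llt ρ (suc m) z)) ∎
      where
      z′ = z ∘ Fin.suc
      open AdjoinVariable (z Fin.zero) (λ r → llt r m z′) (e R m z′) (llt-rec m z′) (e-zero m z′)

    LLTRecursion-unique : ∀ {e X Y} → LLTRecursion e X → LLTRecursion e Y → X 0 ≈ Y 0 → ∀ n → X n ≈ Y n
    LLTRecursion-unique {e} {X} {Y} X-rec Y-rec X₀≈Y₀ = <-rec _ agree
      where
      agree : ∀ n → (∀ {ρ} → ρ ℕ.< n → X ρ ≈ Y ρ) → X n ≈ Y n
      agree zero    _  = X₀≈Y₀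
      agree (suc n) ih = begin
        X (suc n)                                                ≈⟨ X-rec n ⟩
        ∑₂ n (λ β ρ → pochhammer ρ β * (e (suc β) * X ρ))
          ≈⟨ ∑₂-cong n (λ β ρ β+ρ≡n → *-congˡ (*-congˡ (ih (s≤s (≡.subst (ρ ℕ.≤_) β+ρ≡n (ℕₚ.m≤n+m ρ β)))))) ⟩
        ∑₂ n (λ β ρ → pochhammer ρ β * (e (suc β) * Y ρ))        ≈⟨ Y-rec n ⟨
        Y (suc n)                                                ∎

    -- The right-hand side

    module RHSRecursion (m : ℕ) (z : Fin m → Carrier) where

      e′ : ℕ → Carrier
      e′ = e R m z

      weight : ℕ → {k : ℕ} → Subset k → Carrier
      weight σ {k} I = ∏ (List.allFin k) (λ j → if lookup I j then 1# else t^ σ ℕ.+ suc (Fin.toℕ j) −1)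

      -- The right-hand side with each factor t^j − 1 shifted to t^(σ+j) − 1 and the first part of P(I) enlarged by c.
      rhsSum : ℕ → ℕ → ℕ → Carrier
      rhsSum σ c k = ∑ (allSubsets k) (λ I → weight σ I * eλ R m z (partsGo c I))

      rhsSum-zero : ∀ σ c → rhsSum σ c 0 ≈ e′ (suc c)
      rhsSum-zero σ c = solve 1 (λ x → con 1 :* (x :* con 1) :+ con 0 := x) refl (e′ (suc c))

      rhsSum-suc : ∀ σ c k → rhsSum σ c (suc k) ≈ e′ (suc c) * rhsSum (suc σ) 0 k + t^ suc σ −1 * rhsSum (suc σ) (suc c) k
      rhsSum-suc σ c k = begin
        rhsSum σ c (suc k)                                                 ≈⟨ ∑-concatMap _ (allSubsets k) _ ⟩
        ∑ (allSubsets k) (λ I → term true I + (term false I + 0#))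
          ≈⟨ ∑-cong (allSubsets k) (λ I → +-cong (cut I) (trans (+-identityʳ _) (no-cut I))) ⟩
        ∑ (allSubsets k) (λ I → e′ (suc c) * (weight (suc σ) I * eλ R m z (partsGo 0 I))
                              + t^ suc σ −1 * (weight (suc σ) I * eλ R m z (partsGo (suc c) I)))
          ≈⟨ ∑-+ (allSubsets k) _ _ ⟩
        ∑ (allSubsets k) (λ I → e′ (suc c) * (weight (suc σ) I * eλ R m z (partsGo 0 I)))
          + ∑ (allSubsets k) (λ I → t^ suc σ −1 * (weight (suc σ) I * eλ R m z (partsGo (suc c) I)))
          ≈⟨ +-cong (*-distribˡ-∑ (allSubsets k) _ _) (*-distribˡ-∑ (allSubsets k) _ _) ⟨
        e′ (suc c) * rhsSum (suc σ) 0 k + t^ suc σ −1 * rhsSum (suc σ) (suc c) k ∎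
        where
        term : Bool → Subset k → Carrier
        term b I = weight σ (b ∷ I) * eλ R m z (partsGo c (b ∷ I))

        weight-shift : ∀ I → ∏ (List.allFin k) (λ j → if lookup I j then 1# else t^ σ ℕ.+ suc (suc (Fin.toℕ j)) −1)
                           ≈ weight (suc σ) I
        weight-shift I = ∏-cong (List.allFin k) (λ j →
          reflexive (≡.cong (λ a → if lookup I j then 1# else t^ a −1) (ℕₚ.+-suc σ (suc (Fin.toℕ j)))))

        cut : ∀ I → term true I ≈ e′ (suc c) * (weight (suc σ) I * eλ R m z (partsGo 0 I))
        cut I = begin
          weight σ (true ∷ I) * (e′ (suc c) * eλ R m z (partsGo 0 I))
            ≈⟨ *-congʳ (trans (reflexive (∏-allFin-suc k _)) (*-congˡ (weight-shift I))) ⟩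
          (1# * weight (suc σ) I) * (e′ (suc c) * eλ R m z (partsGo 0 I))
            ≈⟨ solve 3 (λ w a b → (con 1 :* w) :* (a :* b) := a :* (w :* b)) refl (weight (suc σ) I) (e′ (suc c)) _ ⟩
          e′ (suc c) * (weight (suc σ) I * eλ R m z (partsGo 0 I)) ∎

        no-cut : ∀ I → term false I ≈ t^ suc σ −1 * (weight (suc σ) I * eλ R m z (partsGo (suc c) I))
        no-cut I = begin
          weight σ (false ∷ I) * eλ R m z (partsGo (suc c) I)
            ≈⟨ *-congʳ (trans (reflexive (∏-allFin-suc k _))
                              (*-cong (reflexive (≡.cong t^_−1 (ℕₚ.+-comm σ 1))) (weight-shift I))) ⟩
          (t^ suc σ −1 * weight (suc σ) I) * eλ R m z (partsGo (suc c) I) ≈⟨ *-assoc _ _ _ ⟩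
          t^ suc σ −1 * (weight (suc σ) I * eλ R m z (partsGo (suc c) I)) ∎

      -- Terms of rhsSum grouped by the last part of P(I), of size β + 1: ρ = 0 means I = ∅, otherwise ρ = max I
      -- (positions counted from 1).
      lastBlock : ℕ → ℕ → ℕ → ℕ → Carrier
      lastBlock σ c β zero    = e′ (suc (c ℕ.+ β))
      lastBlock σ c β (suc ρ) = e′ (suc β) * rhsSum σ c ρ

      lastBlockTerm : ℕ → ℕ → ℕ → ℕ → Carrier
      lastBlockTerm σ c β ρ = pochhammer (σ ℕ.+ ρ) β * lastBlock σ c β ρ

      lastBlockSum : ℕ → ℕ → ℕ → Carrier
      lastBlockSum σ c k = ∑₂ k (lastBlockTerm σ c)

      lastBlockSum-suc : ∀ σ c k →
        lastBlockSum σ c (suc k) ≈ e′ (suc c) * lastBlockSum (suc σ) 0 k + t^ suc σ −1 * lastBlockSum (suc σ) (suc c) k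
      lastBlockSum-suc σ c zero = begin
        1# * (e′ 1 * rhsSum σ c 0) + (t^ suc (σ ℕ.+ 0) −1 * 1#) * e′ (suc (c ℕ.+ 1))
          ≈⟨ +-cong (*-congˡ (*-congˡ (rhsSum-zero σ c)))
                    (*-cong (*-congʳ (reflexive (≡.cong (t^_−1 ∘ suc) (ℕₚ.+-identityʳ σ))))
                            (reflexive (≡.cong (e′ ∘ suc) (ℕₚ.+-comm c 1)))) ⟩
        1# * (e′ 1 * e′ (suc c)) + (t^ suc σ −1 * 1#) * e′ (suc (suc c))
          ≈⟨ solve 4 (λ a b n d → con 1 :* (b :* a) :+ (n :* con 1) :* d := a :* (con 1 :* b) :+ n :* (con 1 :* d))
                     refl (e′ (suc c)) (e′ 1) (t^ suc σ −1) (e′ (suc (suc c))) ⟩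
        e′ (suc c) * (1# * e′ 1) + t^ suc σ −1 * (1# * e′ (suc (suc c)))
          ≈⟨ +-congˡ (*-congˡ (*-congˡ (reflexive (≡.cong (e′ ∘ suc) (ℕₚ.+-identityʳ (suc c)))))) ⟨
        e′ (suc c) * lastBlockSum (suc σ) 0 0 + t^ suc σ −1 * lastBlockSum (suc σ) (suc c) 0 ∎
      lastBlockSum-suc σ c (suc k) = begin
        lastBlockSum σ c (suc (suc k))
          ≈⟨ trans (∑₂-sucʳ (suc k) (lastBlockTerm σ c)) (+-congˡ (∑₂-sucʳ k (λ β ρ → lastBlockTerm σ c β (suc ρ)))) ⟩
        pochhammer (σ ℕ.+ 0) (suc (suc k)) * e′ (suc (c ℕ.+ suc (suc k)))
          + (pochhammer (σ ℕ.+ 1) (suc k) * (e′ (suc (suc k)) * rhsSum σ c 0)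
             + ∑₂ k (λ β ρ → pochhammer (σ ℕ.+ suc (suc ρ)) β * (e′ (suc β) * rhsSum σ c (suc ρ))))
          ≈⟨ +-cong no-cut (+-cong cut-at-end cut-before-end) ⟩
        N * (p * ec₂) + (ec * (p * ek) + (ec * X₀ + N * X₁))
          ≈⟨ solve 7 (λ ec N p ek X₀ ec₂ X₁ → N :* (p :* ec₂) :+ (ec :* (p :* ek) :+ (ec :* X₀ :+ N :* X₁))
                                           := ec :* (p :* ek :+ X₀) :+ N :* (p :* ec₂ :+ X₁))
                     refl ec N p ek X₀ ec₂ X₁ ⟩
        ec * (p * ek + X₀) + N * (p * ec₂ + X₁)
          ≈⟨ +-cong (*-congˡ (∑₂-sucʳ k (lastBlockTerm (suc σ) 0))) (*-congˡ (∑₂-sucʳ k (lastBlockTerm (suc σ) (suc c)))) ⟨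
        ec * lastBlockSum (suc σ) 0 (suc k) + N * lastBlockSum (suc σ) (suc c) (suc k) ∎
        where
        ec = e′ (suc c)
        N = t^ suc σ −1
        p = pochhammer (suc σ ℕ.+ 0) (suc k)
        ek = e′ (suc (suc k))
        ec₂ = e′ (suc (suc c ℕ.+ suc k))
        X₀ = ∑₂ k (λ β ρ → pochhammer (suc σ ℕ.+ suc ρ) β * (e′ (suc β) * rhsSum (suc σ) 0 ρ))
        X₁ = ∑₂ k (λ β ρ → pochhammer (suc σ ℕ.+ suc ρ) β * (e′ (suc β) * rhsSum (suc σ) (suc c) ρ))

        no-cut : pochhammer (σ ℕ.+ 0) (suc (suc k)) * e′ (suc (c ℕ.+ suc (suc k))) ≈ N * (p * ec₂)
        no-cut = trans (*-cong (*-congʳ (reflexive (≡.cong (t^_−1 ∘ suc) (ℕₚ.+-identityʳ σ))))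
                               (reflexive (≡.cong (e′ ∘ suc) (ℕₚ.+-suc c (suc k)))))
                       (*-assoc _ _ _)

        cut-at-end : pochhammer (σ ℕ.+ 1) (suc k) * (e′ (suc (suc k)) * rhsSum σ c 0) ≈ ec * (p * ek)
        cut-at-end = trans (*-cong (reflexive (≡.cong (λ a → pochhammer a (suc k)) (ℕₚ.+-suc σ 0))) (*-congˡ (rhsSum-zero σ c)))
                           (solve 3 (λ p a b → p :* (a :* b) := b :* (p :* a)) refl p ek ec)

        cut-before-end : ∑₂ k (λ β ρ → pochhammer (σ ℕ.+ suc (suc ρ)) β * (e′ (suc β) * rhsSum σ c (suc ρ)))
                       ≈ ec * X₀ + N * X₁
        cut-before-end = begin
          ∑₂ k (λ β ρ → pochhammer (σ ℕ.+ suc (suc ρ)) β * (e′ (suc β) * rhsSum σ c (suc ρ)))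
            ≈⟨ ∑₂-cong k (λ β ρ _ → trans (*-cong (reflexive (≡.cong (λ a → pochhammer a β) (ℕₚ.+-suc σ (suc ρ))))
                                                   (*-congˡ (rhsSum-suc σ c ρ)))
                 (solve 6 (λ p eb ec s₀ N s₁ → p :* (eb :* (ec :* s₀ :+ N :* s₁))
                                             := ec :* (p :* (eb :* s₀)) :+ N :* (p :* (eb :* s₁)))
                    refl (pochhammer (suc σ ℕ.+ suc ρ) β) (e′ (suc β)) ec (rhsSum (suc σ) 0 ρ) N (rhsSum (suc σ) (suc c) ρ))) ⟩
          ∑₂ k (λ β ρ → ec * (pochhammer (suc σ ℕ.+ suc ρ) β * (e′ (suc β) * rhsSum (suc σ) 0 ρ))
                      + N * (pochhammer (suc σ ℕ.+ suc ρ) β * (e′ (suc β) * rhsSum (suc σ) (suc c) ρ)))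
            ≈⟨ ∑₂-+ k _ _ ⟩
          ∑₂ k (λ β ρ → ec * (pochhammer (suc σ ℕ.+ suc ρ) β * (e′ (suc β) * rhsSum (suc σ) 0 ρ)))
            + ∑₂ k (λ β ρ → N * (pochhammer (suc σ ℕ.+ suc ρ) β * (e′ (suc β) * rhsSum (suc σ) (suc c) ρ)))
            ≈⟨ +-cong (*-distribˡ-∑₂ k ec _) (*-distribˡ-∑₂ k N _) ⟨
          ec * X₀ + N * X₁ ∎

      rhsSum≈lastBlockSum : ∀ k σ c → rhsSum σ c k ≈ lastBlockSum σ c k
      rhsSum≈lastBlockSum zero σ c =
        trans (rhsSum-zero σ c) (sym (trans (*-identityˡ _) (reflexive (≡.cong (e′ ∘ suc) (ℕₚ.+-identityʳ c)))))
      rhsSum≈lastBlockSum (suc k) σ c = begin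
        rhsSum σ c (suc k)
          ≈⟨ rhsSum-suc σ c k ⟩
        e′ (suc c) * rhsSum (suc σ) 0 k + t^ suc σ −1 * rhsSum (suc σ) (suc c) k
          ≈⟨ +-cong (*-congˡ (rhsSum≈lastBlockSum k (suc σ) 0)) (*-congˡ (rhsSum≈lastBlockSum k (suc σ) (suc c))) ⟩
        e′ (suc c) * lastBlockSum (suc σ) 0 k + t^ suc σ −1 * lastBlockSum (suc σ) (suc c) k
          ≈⟨ lastBlockSum-suc σ c k ⟨
        lastBlockSum σ c (suc k) ∎

      rhs : ℕ → Carrier
      rhs zero    = 1#
      rhs (suc k) = rhsSum 0 0 k

      rhs-rec : LLTRecursion e′ rhs
      rhs-rec k = trans (rhsSum≈lastBlockSum k 0 0) (∑₂-cong k (λ β ρ _ → *-congˡ (lastBlock≈ β ρ)))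
        where
        lastBlock≈ : ∀ β ρ → lastBlock 0 0 β ρ ≈ e′ (suc β) * rhs ρ
        lastBlock≈ β zero    = sym (*-identityʳ _)
        lastBlock≈ β (suc ρ) = refl

      llt≈rhs : ∀ k → llt (suc k) m z ≈ rhsSum 0 0 k
      llt≈rhs k = LLTRecursion-unique {e′} (llt-rec m z) rhs-rec (llt-zero m z) (suc k)

-- RHS R k m z q unfolds to rhsSum 0 0 k at t = q + 1.
corollary7p2 : {c ℓ : Level} (R : CommutativeRing c ℓ) (k m : ℕ)
               (z : Fin m → CommutativeRing.Carrier R) (q : CommutativeRing.Carrier R) →
               CommutativeRing._≈_ R
                 (LLT R (suc k) m z (CommutativeRing._+_ R q (CommutativeRing.1# R)))
                 (RHS R k m z q)
corollary7p2 R k m z q = RHSRecursion.llt≈rhs R (q + 1#) m z k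
  where open CommutativeRing R using (_+_; 1#)
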